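{- Let $\alpha,\beta$ be prenamings with $C^+(\alpha)\cap C^+(\beta)=\emptyset$ and $R^+(\alpha)\cap R^+(\beta)=\emptyset$, so that $\alpha\oplus\beta$ is defined, and let $t$ be a term. (1) If $\alpha$ is safe for $t$ and $\beta$ is safe for $t$, then $\alpha\oplus\beta$ is safe for $t$. (2) If $\alpha$ is complete for $t$, then $\alpha\oplus\beta$ is complete (hence safe) for $t$, and $(\alpha\oplus\beta)(t)=\alpha(t)$.
   Context: $V$ is a countably infinite set of variables, $\mathrm{vars}(t)$ the set of variables of a term $t$. A substitution maps variables to terms with finite active domain $\mathrm{Dom}(\theta)=\{x:\theta(x)\neq x\}$, extended homomorphically to terms. A prenaming is a substitution $\alpha$ mapping variables to variables together with a fixed finite set $C^+(\alpha)\supseteq\mathrm{Dom}(\alpha)$ (relaxed core) on which $\alpha$ is injective; $R^+(\alpha)=\alpha(C^+(\alpha))$. The sum $\alpha\oplus\beta$ is the prenaming with relaxed core $C^+(\alpha)\cup C^+(\beta)$ agreeing with $\alpha$ on $C^+(\alpha)$, with $\beta$ on $C^+(\beta)$, identity elsewhere. $\mathrm{noninj}(\alpha)=R^+(\alpha)\setminus C^+(\alpha)$, $\mathrm{indom}(\alpha)=V\setminus\mathrm{noninj}(\alpha)$. $\alpha$ is safe for $t$ if $\mathrm{vars}(t)\subseteq\mathrm{indom}(\alpha)$, and complete for $t$ if $\mathrm{vars}(t)\subseteq C^+(\alpha)$. -}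

module Defs where

open import Data.Nat using (ℕ; _≟_)
open import Data.List using (List; []; _∷_; _++_)
open import Data.List.Membership.Propositional using (_∈_; _∉_)
open import Data.List.Membership.DecPropositional _≟_ using (_∈?_)
open import Data.Product using (Σ; _×_; ∃; _,_)
open import Relation.Nullary using (¬_; yes; no)
open import Relation.Binary.PropositionalEquality using (_≡_; _≢_)

Var : Set
Var = ℕ

data Term (F : Set) : Set where
  var : Var → Term F
  app : F → List (Term F) → Term F

data _∈vars_ {F : Set} (x : Var) : Term F → Set
data _∈varsL_ {F : Set} (x : Var) : List (Term F) → Set

data _∈vars_ {F} x where
  here : x ∈vars var x
  inApp : ∀ {f ts} → x ∈varsL ts → x ∈vars app f ts

data _∈varsL_ {F} x where
  hd : ∀ {t ts} → x ∈vars t → x ∈varsL (t ∷ ts)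
  tl : ∀ {t ts} → x ∈varsL ts → x ∈varsL (t ∷ ts)

rename : {F : Set} → (Var → Var) → Term F → Term F
renameL : {F : Set} → (Var → Var) → List (Term F) → List (Term F)
rename ρ (var x) = var (ρ x)
rename ρ (app f ts) = app f (renameL ρ ts)
renameL ρ [] = []
renameL ρ (t ∷ ts) = rename ρ t ∷ renameL ρ ts

-- Raw data of a prenaming: the variable map and the relaxed core C⁺ (finite, as a list).
record PreData : Set where
  constructor mkPre
  field
    map  : Var → Var
    core : List Var
open PreData public

record IsPrenaming (α : PreData) : Set where
  field
    dom⊆core : ∀ x → map α x ≢ x → x ∈ core α
    injCore  : ∀ x y → x ∈ core α → y ∈ core α → map α x ≡ map α y → x ≡ y

_∈C⁺_ : Var → PreData → Set
x ∈C⁺ α = x ∈ core α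

_∈R⁺_ : Var → PreData → Set
x ∈R⁺ α = Σ Var λ y → y ∈ core α × map α y ≡ x

_∈noninj_ : Var → PreData → Set
x ∈noninj α = x ∈R⁺ α × ¬ (x ∈C⁺ α)

_∈indom_ : Var → PreData → Set
x ∈indom α = ¬ (x ∈noninj α)

Safe : {F : Set} → PreData → Term F → Set
Safe α t = ∀ x → x ∈vars t → x ∈indom α

Complete : {F : Set} → PreData → Term F → Set
Complete α t = ∀ x → x ∈vars t → x ∈C⁺ α

CoresDisjoint : PreData → PreData → Set
CoresDisjoint α β = ∀ x → x ∈C⁺ α → ¬ (x ∈C⁺ β)

RangesDisjoint : PreData → PreData → Set
RangesDisjoint α β = ∀ x → x ∈R⁺ α → ¬ (x ∈R⁺ β)

sumMap : PreData → PreData → Var → Var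
sumMap α β x with x ∈? core α
... | yes _ = map α x
... | no _ with x ∈? core β
...   | yes _ = map β x
...   | no _ = x

_⊕_ : PreData → PreData → PreData
α ⊕ β = mkPre (sumMap α β) (core α ++ core β)

apply : {F : Set} → PreData → Term F → Term F
apply α t = rename (map α) t

module Submission where

open import Defs
open import Data.Nat using (_≟_)
open import Data.List using (List; []; _∷_; _++_)
open import Data.List.Membership.Propositional using (_∈_; _∉_)
open import Data.List.Membership.Propositional.Properties using (∈-++⁺ˡ; ∈-++⁺ʳ; ∈-++⁻)
open import Data.List.Membership.DecPropositional _≟_ using (_∈?_)
open import Data.Product using (_×_; _,_)
open import Data.Sum using (_⊎_; inj₁; inj₂; [_,_])
open import Relation.Nullary using (Dec; yes; no; contradiction)
open import Relation.Binary.PropositionalEquality using (_≡_; refl; trans; sym; cong; cong₂)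

sumMap-coreˡ : ∀ α β {x} → x ∈ core α → sumMap α β x ≡ map α x
sumMap-coreˡ α β {x} x∈α with x ∈? core α
... | yes _  = refl
... | no x∉α = contradiction x∈α x∉α

sumMap-coreʳ : ∀ α β {x} → x ∉ core α → x ∈ core β → sumMap α β x ≡ map β x
sumMap-coreʳ α β {x} x∉α x∈β with x ∈? core α
... | yes x∈α = contradiction x∈α x∉α
... | no _ with x ∈? core β
...   | yes _  = refl
...   | no x∉β = contradiction x∈β x∉β

R⁺-⊕ : ∀ α β {x} → x ∈R⁺ (α ⊕ β) → x ∈R⁺ α ⊎ x ∈R⁺ β
R⁺-⊕ α β {x} (y , y∈αβ , αβy≡x) = case-core (y ∈? core α)
  where
  case-core : Dec (y ∈ core α) → x ∈R⁺ α ⊎ x ∈R⁺ β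
  case-core (yes y∈α) = inj₁ (y , y∈α , trans (sym (sumMap-coreˡ α β y∈α)) αβy≡x)
  case-core (no y∉α) with ∈-++⁻ (core α) y∈αβ
  ... | inj₁ y∈α = contradiction y∈α y∉α
  ... | inj₂ y∈β = inj₂ (y , y∈β , trans (sym (sumMap-coreʳ α β y∉α y∈β)) αβy≡x)

noninj-⊕ : ∀ α β {x} → x ∈noninj (α ⊕ β) → x ∈noninj α ⊎ x ∈noninj β
noninj-⊕ α β (x∈R , x∉αβ) =
  [ (λ x∈Rα → inj₁ (x∈Rα , λ x∈α → x∉αβ (∈-++⁺ˡ x∈α)))
  , (λ x∈Rβ → inj₂ (x∈Rβ , λ x∈β → x∉αβ (∈-++⁺ʳ (core α) x∈β)))
  ] (R⁺-⊕ α β x∈R)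

indom-⊕ : ∀ α β {x} → x ∈indom α → x ∈indom β → x ∈indom (α ⊕ β)
indom-⊕ α β x∈α x∈β x∈noninj = [ x∈α , x∈β ] (noninj-⊕ α β x∈noninj)

C⁺⇒indom : ∀ α {x} → x ∈C⁺ α → x ∈indom α
C⁺⇒indom α x∈C (_ , x∉C) = x∉C x∈C

Safe-⊕ : ∀ {F} α β (t : Term F) → Safe α t → Safe β t → Safe (α ⊕ β) t
Safe-⊕ α β t safeα safeβ x x∈t = indom-⊕ α β (safeα x x∈t) (safeβ x x∈t)

Complete⇒Safe : ∀ {F} α (t : Term F) → Complete α t → Safe α t
Complete⇒Safe α t complete x x∈t = C⁺⇒indom α (complete x x∈t)

Complete-⊕ˡ : ∀ {F} α β (t : Term F) → Complete α t → Complete (α ⊕ β) t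
Complete-⊕ˡ α β t complete x x∈t = ∈-++⁺ˡ (complete x x∈t)

rename-cong : ∀ {F} {f g : Var → Var} (t : Term F) → (∀ x → x ∈vars t → f x ≡ g x) → rename f t ≡ rename g t
renameL-cong : ∀ {F} {f g : Var → Var} (ts : List (Term F)) → (∀ x → x ∈varsL ts → f x ≡ g x) → renameL f ts ≡ renameL g ts
rename-cong (var x)    f≗g = cong var (f≗g x here)
rename-cong (app s ts) f≗g = cong (app s) (renameL-cong ts (λ x x∈ts → f≗g x (inApp x∈ts)))
renameL-cong []       f≗g = refl
renameL-cong (t ∷ ts) f≗g =
  cong₂ _∷_ (rename-cong t (λ x x∈t → f≗g x (hd x∈t))) (renameL-cong ts (λ x x∈ts → f≗g x (tl x∈ts)))

apply-⊕-complete : ∀ {F} α β (t : Term F) → Complete α t → apply (α ⊕ β) t ≡ apply α t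
apply-⊕-complete α β t complete = rename-cong t (λ x x∈t → sumMap-coreˡ α β (complete x x∈t))

mainTheorem4 : {F : Set} (α β : PreData) → IsPrenaming α → IsPrenaming β
               → CoresDisjoint α β → RangesDisjoint α β → (t : Term F)
               → (Safe α t → Safe β t → Safe (α ⊕ β) t)
                 × (Complete α t → Complete (α ⊕ β) t × Safe (α ⊕ β) t × apply (α ⊕ β) t ≡ apply α t)
mainTheorem4 α β _ _ _ _ t =
  Safe-⊕ α β t ,
  λ complete → let completeαβ = Complete-⊕ˡ α β t complete in
    completeαβ , Complete⇒Safe (α ⊕ β) t completeαβ , apply-⊕-complete α β t complete
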